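{- Let $x=\frac{n}{d}$ be a rational number with $\gcd(n,d)=1$ and $0<x<1$, and let $p$ be a prime such that $x-1\in\mathbb{Z}_p^\times$. Let $M$ be the multiplicative order of $p$ modulo $d$, and let $x-1=\sum_{j\ge 0}x_jp^j$ (with $x_j\in\{0,1,\dots,p-1\}$) be the $p$-adic expansion of $x-1$. Then for each index $0\le j<M$, \[ x_j=\left\lfloor \left\{ -p^{M-1-j}x\right\}p\right\rfloor . \]
   Context: For a real number $y$, $\lfloor y\rfloor$ is the unique integer with $\lfloor y\rfloor\le y<\lfloor y\rfloor+1$, and $\{y\}=y-\lfloor y\rfloor$ is its fractional part. $\mathbb{Z}_p^\times$ denotes the units of the ring of $p$-adic integers. -}

module Defs where

open import Data.Nat as ℕ using (ℕ; zero; suc; _<_; _^_; _%_; NonZero)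
open import Data.Integer as ℤ using (ℤ; +_)
open import Data.Rational as ℚ using (ℚ; floor; _/_)
open import Relation.Binary.PropositionalEquality using (_≡_; _≢_)
open import Data.Product using (_×_)
open import Data.Integer.Divisibility as ℤd using ()

-- fractional part {y} = y - ⌊y⌋ (floor-based, so {y} ∈ [0,1))
frac : ℚ → ℚ
frac y = y ℚ.- (floor y / 1)

IsMultOrder : (p d M : ℕ) → .{{_ : NonZero d}} → Set
IsMultOrder p d M =
  (0 < M) × ((p ^ M) % d ≡ 1) × (∀ k → 0 < k → k < M → (p ^ k) % d ≢ 1)

partialSum : (p : ℕ) → (ℕ → ℕ) → ℕ → ℤ
partialSum p f zero = + 0
partialSum p f (suc k) = partialSum p f k ℤ.+ (+ (f k ℕ.* p ^ k))

-- f is the p-adic digit expansion of the p-adic integer a / d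
-- (d a p-adic unit): digits in {0,…,p-1} and
-- d * Σ_{j<k} f j p^j ≡ a (mod p^k) for every k
IsPAdicExpansion : (p : ℕ) → (a : ℤ) → (d : ℕ) → (ℕ → ℕ) → Set
IsPAdicExpansion p a d f =
  (∀ j → f j < p) ×
  (∀ k → (+ (p ^ k)) ℤd.∣ ((+ d) ℤ.* partialSum p f k ℤ.- a))

module Submission where

-- Write x = n/d with 0 < n < d and put D = d − n, so that x − 1 = −D/d.  The
-- expansion hypothesis says  d·S_k + D ≡ 0 (mod p^k)  for the partial digit sums
-- S_k = Σ_{i<k} x_i p^i, i.e.  d·S_k + D = s_k·p^k  for "tail numerators" s_k.
--
--  * TailNumerators: 0 ≤ s_k < d, and the digit recurrence  s_j + d·x_j = p·s_{j+1};
--    hence x_j = ⌊p·s_{j+1}/d⌋.  Moreover, since p^M ≡ 1 (mod d),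
--    s_{j+1} ≡ s_{j+1}·p^M = (d·S_{j+1} + D)·p^{M−1−j} ≡ −n·p^{M−1−j} (mod d).
--  * IntegerBridge: transports these ℕ-identities to ℤ; in particular
--    −p^{M−1−j}·n = (−c)·d + s_{j+1} for some c, a Euclidean division.
--  * FloorAndFraction: for y = (z·d + s)/d with 0 ≤ s < d one has {y} = s/d and
--    ⌊{y}·p⌋ = ⌊s·p/d⌋, computed through unnormalised representatives.
--  * Finally the hypotheses of the theorem are put into these forms.
--
-- Applied to y = −p^{M−1−j}·x this gives ⌊{y}·p⌋ = ⌊p·s_{j+1}/d⌋ = x_j.

open import Defs

module TailNumerators where
  open import Data.Nat
  open import Data.Nat.Properties
  open import Data.Nat.DivMod using (_%_; _/_; m≡m%n+[m/n]*n)
  open import Data.Nat.Divisibility using (_∣_; ∣m+n∣m⇒∣n; n∣m*n; m∣m*n)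
  open import Data.Nat.Tactic.RingSolver using (solve-∀)
  open import Data.Integer as ℤ using ()
  open import Data.Integer.Properties using (pos-+)
  open import Relation.Binary.PropositionalEquality

  digitSum : ℕ → (ℕ → ℕ) → ℕ → ℕ
  digitSum p f zero    = 0
  digitSum p f (suc k) = digitSum p f k + f k * p ^ k

  partialSum≡digitSum : ∀ p f k → partialSum p f k ≡ ℤ.+ digitSum p f k
  partialSum≡digitSum p f zero    = refl
  partialSum≡digitSum p f (suc k) =
    trans (cong (ℤ._+ ℤ.+ (f k * p ^ k)) (partialSum≡digitSum p f k))
          (sym (pos-+ (digitSum p f k) (f k * p ^ k)))

  digitSum<p^k : ∀ p f → (∀ j → f j < p) → ∀ k → digitSum p f k < p ^ k
  digitSum<p^k p f digit<p zero    = s≤s z≤n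
  digitSum<p^k p f digit<p (suc k) = begin-strict
    digitSum p f k + f k * p ^ k  <⟨ +-monoˡ-< (f k * p ^ k) (digitSum<p^k p f digit<p k) ⟩
    p ^ k + f k * p ^ k           ≡⟨⟩
    suc (f k) * p ^ k             ≤⟨ *-monoˡ-≤ (p ^ k) (digit<p k) ⟩
    p * p ^ k                     ∎
    where open ≤-Reasoning

  -- Tail numerators of the p-adic expansion of −D/d.  If  d·S_k + D ≡ 0 (mod p^k)
  -- for all partial sums S_k, then  (−D/d − S_k)/p^k = −s_k/d  for a natural s_k.
  module Tails (p d D : ℕ) (f : ℕ → ℕ) (digit<p : ∀ j → f j < p) (D<d : D < d)
               (expansion : ∀ k → p ^ k ∣ d * digitSum p f k + D) where

    tail : ℕ → ℕ
    tail k = _∣_.quotient (expansion k)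

    tail-eq : ∀ k → d * digitSum p f k + D ≡ tail k * p ^ k
    tail-eq k = _∣_.equality (expansion k)

    instance
      p≢0 : NonZero p
      p≢0 = >-nonZero (≤-<-trans z≤n (digit<p 0))

    tail<d : ∀ k → tail k < d
    tail<d k = *-cancelʳ-< (p ^ k) (tail k) d (begin-strict
      tail k * p ^ k        ≡⟨ sym (tail-eq k) ⟩
      d * S + D             <⟨ +-monoʳ-< (d * S) D<d ⟩
      d * S + d             ≡⟨ +-comm (d * S) d ⟩
      d + d * S             ≡⟨ cong (d +_) (*-comm d S) ⟩
      suc S * d             ≤⟨ *-monoˡ-≤ d (digitSum<p^k p f digit<p k) ⟩
      p ^ k * d             ≡⟨ *-comm (p ^ k) d ⟩
      d * p ^ k             ∎)
      where
      open ≤-Reasoning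
      S : ℕ
      S = digitSum p f k

    tail-step : ∀ j → tail j + f j * d ≡ p * tail (suc j)
    tail-step j = *-cancelʳ-≡ (tail j + f j * d) (p * tail (suc j)) (p ^ j) {{m^n≢0 p j}} (begin
      (tail j + f j * d) * p ^ j       ≡⟨ *-distribʳ-+ (p ^ j) (tail j) (f j * d) ⟩
      tail j * p ^ j + f j * d * p ^ j ≡⟨ cong (_+ f j * d * p ^ j) (sym (tail-eq j)) ⟩
      d * S + D + f j * d * p ^ j      ≡⟨ append-digit d S D (f j) (p ^ j) ⟩
      d * (S + f j * p ^ j) + D        ≡⟨ tail-eq (suc j) ⟩
      tail (suc j) * (p * p ^ j)       ≡⟨ shift (tail (suc j)) p (p ^ j) ⟩
      p * tail (suc j) * p ^ j         ∎)
      where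
      open ≡-Reasoning
      S : ℕ
      S = digitSum p f j
      append-digit : ∀ d S D x P → d * S + D + x * d * P ≡ d * (S + x * P) + D
      append-digit = solve-∀
      shift : ∀ t p P → t * (p * P) ≡ p * t * P
      shift = solve-∀

  -- If A·B ≡ 1 (mod d) and d·S + D = s·B with D + n = d,
  -- then s ≡ −n·A (mod d), because s ≡ s·A·B = (d·S + D)·A ≡ D·A ≡ −n·A.
  inverse-congruence : ∀ A B d D n s S .{{_ : NonZero d}} → (A * B) % d ≡ 1 → D + n ≡ d →
                       d * S + D ≡ s * B → d ∣ s + n * A
  inverse-congruence A B d D n s S AB%d≡1 D+n≡d dS+D≡sB =
    ∣m+n∣m⇒∣n (subst (d ∣_) (sym key) (m∣m*n (S * A + A))) (n∣m*n (s * e))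
    where
    open ≡-Reasoning
    e : ℕ
    e = (A * B) / d
    AB≡1+ed : A * B ≡ 1 + e * d
    AB≡1+ed = trans (m≡m%n+[m/n]*n (A * B) d) (cong (_+ e * d) AB%d≡1)
    key : s * e * d + (s + n * A) ≡ d * (S * A + A)
    key = begin
      s * e * d + (s + n * A)   ≡⟨ expand s e d n A ⟩
      s * (1 + e * d) + n * A   ≡⟨ cong (λ m → s * m + n * A) (sym AB≡1+ed) ⟩
      s * (A * B) + n * A       ≡⟨ regroup s A B n ⟩
      s * B * A + n * A         ≡⟨ cong (λ m → m * A + n * A) (sym dS+D≡sB) ⟩
      (d * S + D) * A + n * A   ≡⟨ collect d S D n A ⟩
      d * S * A + (D + n) * A   ≡⟨ cong (λ m → d * S * A + m * A) D+n≡d ⟩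
      d * S * A + d * A         ≡⟨ factor d S A ⟩
      d * (S * A + A)           ∎
      where
      expand : ∀ s e d n A → s * e * d + (s + n * A) ≡ s * (1 + e * d) + n * A
      expand = solve-∀
      regroup : ∀ s A B n → s * (A * B) + n * A ≡ s * B * A + n * A
      regroup = solve-∀
      collect : ∀ d S D n A → (d * S + D) * A + n * A ≡ d * S * A + (D + n) * A
      collect = solve-∀
      factor : ∀ d S A → d * S * A + d * A ≡ d * (S * A + A)
      factor = solve-∀

module IntegerBridge where
  open import Data.Nat as ℕ using ()
  open import Data.Integer using (+_; -_; _+_; _-_; _*_)
  import Data.Nat.Properties as ℕP
  open import Data.Integer.Properties using (pos-+; pos-*; +-comm)
  open import Data.Integer.Tactic.RingSolver using (solve-∀)
  open import Relation.Binary.PropositionalEquality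

  expansion-numerator : ∀ d S n D → D ℕ.+ n ≡ d → + d * + S - (+ n - + d) ≡ + (d ℕ.* S ℕ.+ D)
  expansion-numerator .(D ℕ.+ n) S n D refl = begin
    + (D ℕ.+ n) * + S - (+ n - + (D ℕ.+ n))  ≡⟨ cong (λ m → m * + S - (+ n - m)) (pos-+ D n) ⟩
    (+ D + + n) * + S - (+ n - (+ D + + n))  ≡⟨ cancel (+ D) (+ n) (+ S) ⟩
    (+ D + + n) * + S + + D                  ≡⟨ cong (λ m → m * + S + + D) (sym (pos-+ D n)) ⟩
    + (D ℕ.+ n) * + S + + D                  ≡⟨ cong (_+ + D) (sym (pos-* (D ℕ.+ n) S)) ⟩
    + ((D ℕ.+ n) ℕ.* S) + + D                ≡⟨ sym (pos-+ ((D ℕ.+ n) ℕ.* S) D) ⟩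
    + ((D ℕ.+ n) ℕ.* S ℕ.+ D)                ∎
    where
    open ≡-Reasoning
    cancel : ∀ D n S → (D + n) * S - (n - (D + n)) ≡ (D + n) * S + D
    cancel = solve-∀

  negative-remainder : ∀ s n A c d → s ℕ.+ n ℕ.* A ≡ c ℕ.* d → - (+ A * + n) ≡ - + c * + d + + s
  negative-remainder s n A c d s+nA≡cd = begin
    - (+ A * + n)            ≡⟨ isolate (+ s) (+ A) (+ n) ⟩
    + s - (+ s + + n * + A)  ≡⟨ cong (λ m → + s - m) cast ⟩
    + s - + c * + d          ≡⟨ rearrange (+ s) (+ c) (+ d) ⟩
    - + c * + d + + s        ∎
    where
    open ≡-Reasoning
    isolate : ∀ s A n → - (A * n) ≡ s - (s + n * A)
    isolate = solve-∀
    rearrange : ∀ s c d → s - c * d ≡ - c * d + s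
    rearrange = solve-∀
    cast : + s + + n * + A ≡ + c * + d
    cast = begin
      + s + + n * + A      ≡⟨ cong (_+_ (+ s)) (sym (pos-* n A)) ⟩
      + s + + (n ℕ.* A)    ≡⟨ sym (pos-+ s (n ℕ.* A)) ⟩
      + (s ℕ.+ n ℕ.* A)    ≡⟨ cong +_ s+nA≡cd ⟩
      + (c ℕ.* d)          ≡⟨ pos-* c d ⟩
      + c * + d            ∎

  recurrence-as-division : ∀ t x d p s → t ℕ.+ x ℕ.* d ≡ p ℕ.* s → + s * + p ≡ + x * + d + + t
  recurrence-as-division t x d p s t+xd≡ps = begin
    + s * + p              ≡⟨ sym (pos-* s p) ⟩
    + (s ℕ.* p)            ≡⟨ cong +_ (trans (ℕP.*-comm s p) (sym t+xd≡ps)) ⟩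
    + (t ℕ.+ x ℕ.* d)      ≡⟨ pos-+ t (x ℕ.* d) ⟩
    + t + + (x ℕ.* d)      ≡⟨ cong (_+_ (+ t)) (pos-* x d) ⟩
    + t + + x * + d        ≡⟨ +-comm (+ t) (+ x * + d) ⟩
    + x * + d + + t        ∎
    where open ≡-Reasoning

module FloorAndFraction where
  open import Data.Nat as ℕ using (suc)
  import Data.Nat.Properties as ℕP
  open import Data.Integer
    using (ℤ; +_; -_; _+_; _-_; _*_; _≤_; _<_; _/ℕ_; +<+) renaming (suc to sucℤ)
  open import Data.Integer.Properties
  open import Data.Integer.DivMod using ([n/ℕd]*d≤n; n<s[n/ℕd]*d; div-pos-is-/ℕ)
  open import Data.Integer.Tactic.RingSolver using (solve-∀)
  open import Data.Rational as ℚ using (mkℚ; floor; toℚᵘ)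
  open import Data.Rational.Properties
    using (toℚᵘ-fromℚᵘ; toℚᵘ-homo-*; toℚᵘ-homo-+; toℚᵘ-homo‿-; toℚᵘ-mono-<)
  open import Data.Rational.Unnormalised as U using (mkℚᵘ; *≡*; *<*; _≃_)
  import Data.Rational.Unnormalised.Properties as UP
  open import Relation.Binary.PropositionalEquality
  open import Relation.Binary.Definitions using (tri<; tri≈; tri>)
  open import Relation.Nullary using (contradiction)

  /ℕ-unique : ∀ a k z → z * + suc k ≤ a → a < sucℤ z * + suc k → a /ℕ suc k ≡ z
  /ℕ-unique a k z lower upper with <-cmp (a /ℕ suc k) z
  ... | tri≈ _ q≡z _ = q≡z
  ... | tri< q<z _ _ = contradiction (<-≤-trans (n<s[n/ℕd]*d a (suc k))
          (≤-trans (*-monoʳ-≤-nonNeg (+ suc k) (i<j⇒suc[i]≤j q<z)) lower)) (<-irrefl refl)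
  ... | tri> _ _ z<q = contradiction (<-≤-trans upper
          (≤-trans (*-monoʳ-≤-nonNeg (+ suc k) (i<j⇒suc[i]≤j z<q)) ([n/ℕd]*d≤n a (suc k))))
          (<-irrefl refl)

  euclid-/ℕ : ∀ z s k → s ℕ.< suc k → (z * + suc k + + s) /ℕ suc k ≡ z
  euclid-/ℕ z s k s<d = /ℕ-unique (z * + suc k + + s) k z
    (i≤i+j (z * + suc k) (+ s))
    (begin-strict
      z * + suc k + + s       <⟨ +-monoʳ-< (z * + suc k) (+<+ s<d) ⟩
      z * + suc k + + suc k   ≡⟨ +-comm (z * + suc k) (+ suc k) ⟩
      + suc k + z * + suc k   ≡⟨ sym (suc-* z (+ suc k)) ⟩
      sucℤ z * + suc k        ∎)
    where open ≤-Reasoning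

  floor-≃ : ∀ r A k → toℚᵘ r ≃ mkℚᵘ A k → floor r ≡ A /ℕ suc k
  floor-≃ r@(mkℚ N m _) A k (*≡* N*d≡A*m) =
    trans (div-pos-is-/ℕ N (suc m)) (/ℕ-unique N m z lower upper)
    where
    open ≤-Reasoning
    z : ℤ
    z = A /ℕ suc k
    swap : ∀ a b c → a * b * c ≡ a * c * b
    swap = solve-∀
    lower : z * + suc m ≤ N
    lower = *-cancelʳ-≤-pos (z * + suc m) N (+ suc k) (begin
      z * + suc m * + suc k  ≡⟨ swap z (+ suc m) (+ suc k) ⟩
      z * + suc k * + suc m  ≤⟨ *-monoʳ-≤-nonNeg (+ suc m) ([n/ℕd]*d≤n A (suc k)) ⟩
      A * + suc m            ≡⟨ sym N*d≡A*m ⟩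
      N * + suc k            ∎)
    upper : N < sucℤ z * + suc m
    upper = *-cancelʳ-<-nonNeg (+ suc k) (begin-strict
      N * + suc k               ≡⟨ N*d≡A*m ⟩
      A * + suc m               <⟨ *-monoʳ-<-pos (+ suc m) (n<s[n/ℕd]*d A (suc k)) ⟩
      sucℤ z * + suc k * + suc m ≡⟨ swap (sucℤ z) (+ suc k) (+ suc m) ⟩
      sucℤ z * + suc m * + suc k ∎)

  /-≃ : ∀ i k → toℚᵘ (i ℚ./ suc k) ≃ mkℚᵘ i k
  /-≃ i k = toℚᵘ-fromℚᵘ (mkℚᵘ i k)

  *-integerʳ : ∀ a b k → mkℚᵘ a k U.* mkℚᵘ b 0 ≃ mkℚᵘ (a * b) k
  *-integerʳ a b k = *≡* (cong (λ m → a * b * + suc m) (sym (ℕP.*-identityʳ k)))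

  *-integerˡ : ∀ a b k → mkℚᵘ b 0 U.* mkℚᵘ a k ≃ mkℚᵘ (b * a) k
  *-integerˡ a b k = *≡* (cong (λ m → b * a * + suc m) (sym (ℕP.+-identityʳ k)))

  -integer : ∀ z s k → mkℚᵘ (z * + suc k + + s) k U.- mkℚᵘ z 0 ≃ mkℚᵘ (+ s) k
  -integer z s k = *≡* (begin
      ((z * d + + s) * + 1 + - z * d) * d  ≡⟨ cancel z (+ s) d ⟩
      + s * d                              ≡⟨ cong (λ m → + s * + suc m) (sym (ℕP.*-identityʳ k)) ⟩
      + s * + suc (k ℕ.* 1)               ∎)
    where
    open ≡-Reasoning
    d : ℤ
    d = + suc k
    cancel : ∀ z s d → ((z * d + s) * + 1 + - z * d) * d ≡ s * d
    cancel = solve-∀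

  frac-euclid : ∀ y z s k → s ℕ.< suc k → toℚᵘ y ≃ mkℚᵘ (z * + suc k + + s) k →
                toℚᵘ (frac y) ≃ mkℚᵘ (+ s) k
  frac-euclid y z s k s<d y≃ = begin
    toℚᵘ (y ℚ.+ ℚ.- (floor y ℚ./ 1))        ≈⟨ toℚᵘ-homo-+ y (ℚ.- (floor y ℚ./ 1)) ⟩
    toℚᵘ y U.+ toℚᵘ (ℚ.- (floor y ℚ./ 1))   ≈⟨ UP.+-cong y≃ (toℚᵘ-homo‿- (floor y ℚ./ 1)) ⟩
    mkℚᵘ (z * + suc k + + s) k U.- toℚᵘ (floor y ℚ./ 1)
                                             ≈⟨ UP.+-congʳ (mkℚᵘ (z * + suc k + + s) k) (UP.-‿cong floor≃z) ⟩
    mkℚᵘ (z * + suc k + + s) k U.- mkℚᵘ z 0  ≈⟨ -integer z s k ⟩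
    mkℚᵘ (+ s) k                             ∎
    where
    open UP.≃-Reasoning
    floor≡z : floor y ≡ z
    floor≡z = trans (floor-≃ y _ k y≃) (euclid-/ℕ z s k s<d)
    floor≃z : toℚᵘ (floor y ℚ./ 1) ≃ mkℚᵘ z 0
    floor≃z = subst (λ w → toℚᵘ (w ℚ./ 1) ≃ mkℚᵘ z 0) (sym floor≡z) (/-≃ z 0)

  floor-frac-scaled : ∀ y z s k p → s ℕ.< suc k → toℚᵘ y ≃ mkℚᵘ (z * + suc k + + s) k →
                      floor (frac y ℚ.* (+ p ℚ./ 1)) ≡ (+ s * + p) /ℕ suc k
  floor-frac-scaled y z s k p s<d y≃ = floor-≃ (frac y ℚ.* (+ p ℚ./ 1)) (+ s * + p) k (begin
    toℚᵘ (frac y ℚ.* (+ p ℚ./ 1))           ≈⟨ toℚᵘ-homo-* (frac y) (+ p ℚ./ 1) ⟩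
    toℚᵘ (frac y) U.* toℚᵘ (+ p ℚ./ 1)      ≈⟨ UP.*-cong (frac-euclid y z s k s<d y≃) (/-≃ (+ p) 0) ⟩
    mkℚᵘ (+ s) k U.* mkℚᵘ (+ p) 0           ≈⟨ *-integerʳ (+ s) (+ p) k ⟩
    mkℚᵘ (+ s * + p) k                      ∎)
    where open UP.≃-Reasoning

  neg-scaled-≃ : ∀ a n k → toℚᵘ (ℚ.- ((a ℚ./ 1) ℚ.* (n ℚ./ suc k))) ≃ mkℚᵘ (- (a * n)) k
  neg-scaled-≃ a n k = begin
    toℚᵘ (ℚ.- ((a ℚ./ 1) ℚ.* (n ℚ./ suc k)))   ≈⟨ toℚᵘ-homo‿- ((a ℚ./ 1) ℚ.* (n ℚ./ suc k)) ⟩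
    U.- toℚᵘ ((a ℚ./ 1) ℚ.* (n ℚ./ suc k))     ≈⟨ UP.-‿cong (toℚᵘ-homo-* (a ℚ./ 1) (n ℚ./ suc k)) ⟩
    U.- (toℚᵘ (a ℚ./ 1) U.* toℚᵘ (n ℚ./ suc k)) ≈⟨ UP.-‿cong (UP.*-cong (/-≃ a 0) (/-≃ n k)) ⟩
    U.- (mkℚᵘ a 0 U.* mkℚᵘ n k)                ≈⟨ UP.-‿cong (*-integerˡ n a k) ⟩
    mkℚᵘ (- (a * n)) k                          ∎
    where open UP.≃-Reasoning

  0<numerator : ∀ n k → ℚ.0ℚ ℚ.< (+ n ℚ./ suc k) → 0 ℕ.< n
  0<numerator n k 0<x with UP.<-respʳ-≃ (/-≃ (+ n) k) (toℚᵘ-mono-< 0<x)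
  ... | *<* 0*d<n*1 = drop‿+<+ (subst₂ _<_ (*-zeroˡ (+ suc k)) (*-identityʳ (+ n)) 0*d<n*1)

  numerator<denominator : ∀ n k → (+ n ℚ./ suc k) ℚ.< ℚ.1ℚ → n ℕ.< suc k
  numerator<denominator n k x<1 with UP.<-respˡ-≃ (/-≃ (+ n) k) (toℚᵘ-mono-< x<1)
  ... | *<* n*1<1*d = drop‿+<+ (subst₂ _<_ (*-identityʳ (+ n)) (*-identityˡ (+ suc k)) n*1<1*d)

open import Data.Nat as ℕ using (ℕ; _<_; _^_; _∸_; NonZero)
open import Data.Nat.GCD using (gcd)
open import Data.Nat.Primality using (Prime)
open import Data.Integer as ℤ using (ℤ; +_)
open import Data.Rational as ℚ using (ℚ; floor; _/_)
open import Relation.Binary.PropositionalEquality using (_≡_)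
open import Relation.Nullary using (¬_)
open import Data.Nat.Divisibility using (_∣_)
open import Data.Integer.Divisibility as ℤd using ()

import Data.Nat.Properties as ℕP
open import Data.Integer using (_/ℕ_)
open import Data.Product using (_,_; proj₁)
open import Relation.Binary.PropositionalEquality using (sym; trans; cong; subst; module ≡-Reasoning)
open import Data.Rational using (toℚᵘ)
open import Data.Rational.Unnormalised using (mkℚᵘ; _≃_)

open TailNumerators
open IntegerBridge
open FloorAndFraction

complementary-exponent : ∀ M j → j < M → M ∸ 1 ∸ j ℕ.+ ℕ.suc j ≡ M
complementary-exponent (ℕ.suc M) j (ℕ.s≤s j≤M) =
  trans (ℕP.+-suc (M ∸ j) j) (cong ℕ.suc (ℕP.m∸n+n≡m j≤M))

expansion-in-ℕ : ∀ p n d D xs → D ℕ.+ n ≡ d → IsPAdicExpansion p ((+ n) ℤ.- (+ d)) d xs →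
                 ∀ i → p ^ i ∣ d ℕ.* digitSum p xs i ℕ.+ D
expansion-in-ℕ p n d D xs D+n≡d (_ , expansion) i = subst (λ e → p ^ i ∣ ℤ.∣ e ∣)
  (trans (cong (λ S → + d ℤ.* S ℤ.- (+ n ℤ.- + d)) (partialSum≡digitSum p xs i))
         (expansion-numerator d (digitSum p xs i) n D D+n≡d))
  (expansion i)

order-congruence : ∀ p d M j D n s S .{{_ : NonZero d}} → (p ^ M) ℕ.% d ≡ 1 → j < M →
                   D ℕ.+ n ≡ d → d ℕ.* S ℕ.+ D ≡ s ℕ.* p ^ ℕ.suc j →
                   d ∣ s ℕ.+ n ℕ.* p ^ (M ∸ 1 ∸ j)
order-congruence p d M j D n s S p^M%d≡1 j<M =
  inverse-congruence (p ^ (M ∸ 1 ∸ j)) (p ^ ℕ.suc j) d D n s S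
    (subst (λ e → e ℕ.% d ≡ 1) p^M≡p^a*p^[j+1] p^M%d≡1)
  where
  p^M≡p^a*p^[j+1] : p ^ M ≡ p ^ (M ∸ 1 ∸ j) ℕ.* p ^ ℕ.suc j
  p^M≡p^a*p^[j+1] = trans (cong (p ^_) (sym (complementary-exponent M j j<M)))
                          (ℕP.^-distribˡ-+-* p (M ∸ 1 ∸ j) (ℕ.suc j))

scaled-fraction-≃ : ∀ a n k c s → s ℕ.+ n ℕ.* a ≡ c ℕ.* ℕ.suc k →
                    toℚᵘ (ℚ.- ((+ a / 1) ℚ.* (+ n / ℕ.suc k))) ≃ mkℚᵘ (ℤ.- + c ℤ.* + ℕ.suc k ℤ.+ + s) k
scaled-fraction-≃ a n k c s s+na≡cd =
  subst (λ e → toℚᵘ (ℚ.- ((+ a / 1) ℚ.* (+ n / ℕ.suc k))) ≃ mkℚᵘ e k)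
        (negative-remainder s n a c (ℕ.suc k) s+na≡cd)
        (neg-scaled-≃ (+ a) (+ n) k)

lemma2p3 : (n d p M : ℕ) → .{{_ : NonZero d}} → (xs : ℕ → ℕ) →
    gcd n d ≡ 1 →
    ℚ.0ℚ ℚ.< (+ n / d) → (+ n / d) ℚ.< ℚ.1ℚ →
    Prime p →
    ¬ (p ∣ d) → ¬ ((+ p) ℤd.∣ ((+ n) ℤ.- (+ d))) →
    IsMultOrder p d M →
    IsPAdicExpansion p ((+ n) ℤ.- (+ d)) d xs →
    (j : ℕ) → j < M →
    + (xs j) ≡ floor (frac (ℚ.- ((+ (p ^ (M ∸ 1 ∸ j)) / 1) ℚ.* (+ n / d))) ℚ.* (+ p / 1))
lemma2p3 n d@(ℕ.suc k) p M xs _ 0<x x<1 _ _ _ (_ , p^M%d≡1 , _) expansion j j<M = begin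
    + xs j                               ≡⟨ sym (euclid-/ℕ (+ xs j) (tail j) k (tail<d j)) ⟩
    (+ xs j ℤ.* + d ℤ.+ + tail j) /ℕ d   ≡⟨ cong (_/ℕ d) (sym digit-division) ⟩
    (+ tail (ℕ.suc j) ℤ.* + p) /ℕ d      ≡⟨ sym (floor-frac-scaled _ (ℤ.- + c) (tail (ℕ.suc j)) k p
                                                   (tail<d (ℕ.suc j)) y≃) ⟩
    floor (frac (ℚ.- ((+ (p ^ (M ∸ 1 ∸ j)) / 1) ℚ.* (+ n / d))) ℚ.* (+ p / 1)) ∎
  where
  open ≡-Reasoning
  n<d : n < d
  n<d = numerator<denominator n k x<1
  D : ℕ
  D = d ∸ n
  D+n≡d : D ℕ.+ n ≡ d
  D+n≡d = ℕP.m∸n+n≡m (ℕP.<⇒≤ n<d)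
  D<d : D < d
  D<d = ℕP.∸-monoʳ-< (0<numerator n k 0<x) (ℕP.<⇒≤ n<d)
  open Tails p d D xs (proj₁ expansion) D<d (expansion-in-ℕ p n d D xs D+n≡d expansion)
  digit-division : + tail (ℕ.suc j) ℤ.* + p ≡ + xs j ℤ.* + d ℤ.+ + tail j
  digit-division = recurrence-as-division (tail j) (xs j) d p (tail (ℕ.suc j)) (tail-step j)
  congruence : d ∣ tail (ℕ.suc j) ℕ.+ n ℕ.* p ^ (M ∸ 1 ∸ j)
  congruence = order-congruence p d M j D n (tail (ℕ.suc j)) _ p^M%d≡1 j<M D+n≡d (tail-eq (ℕ.suc j))
  c : ℕ
  c = _∣_.quotient congruence
  y≃ : toℚᵘ (ℚ.- ((+ (p ^ (M ∸ 1 ∸ j)) / 1) ℚ.* (+ n / d))) ≃ mkℚᵘ (ℤ.- + c ℤ.* + d ℤ.+ + tail (ℕ.suc j)) k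
  y≃ = scaled-fraction-≃ (p ^ (M ∸ 1 ∸ j)) n k c (tail (ℕ.suc j)) (_∣_.equality congruence)
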